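{- Let $r$ be a positive integer and let $T$ be a 2-comparable set of triples in $[r]^3$. Then $|T|\le t(r)$, where $t(r)=3r^2/4$ if $r$ is even and $t(r)=3r^2/4+r/2+3/4$ if $r$ is odd.
   Context: $[r]=\{1,\dots,r\}$. For integer triples $a,b$, write $a<_2b$ if $a_i<b_i$ for at least two indices $i\in\{1,2,3\}$. Two triples are 2-comparable if one is 2-less than the other; a set of triples is 2-comparable if any two distinct elements are 2-comparable. -}

module Defs where

open import Data.Nat using (ℕ; _+_; _*_; _<_; _≤_; _/_; _%_)
open import Data.Product using (_×_; _,_)
open import Data.Sum using (_⊎_)
open import Data.List using (List)
open import Data.List.Relation.Unary.All using (All)
open import Relation.Binary.PropositionalEquality using (_≡_)
open import Relation.Nullary using (¬_)

-- integer triples (entries are naturals; membership in [r]^3 is imposed separately)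
Triple : Set
Triple = ℕ × ℕ × ℕ

_<₂_ : Triple → Triple → Set
(a₁ , a₂ , a₃) <₂ (b₁ , b₂ , b₃) =
  (a₁ < b₁ × a₂ < b₂) ⊎ (a₁ < b₁ × a₃ < b₃) ⊎ (a₂ < b₂ × a₃ < b₃)

2-comparable : Triple → Triple → Set
2-comparable a b = (a <₂ b) ⊎ (b <₂ a)

In[_] : ℕ → ℕ → Set
In[ r ] x = 1 ≤ x × x ≤ r

In[_]³ : ℕ → Triple → Set
In[ r ]³ (a₁ , a₂ , a₃) = In[ r ] a₁ × In[ r ] a₂ × In[ r ] a₃

-- t(r) = 3r²/4 (r even), 3r²/4 + r/2 + 3/4 (r odd); both are integers,
-- so exact natural-number division by 4 is used.
t : ℕ → ℕ
t r with r % 2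
... | 0 = (3 * (r * r)) / 4
... | _ = (3 * (r * r) + 2 * r + 3) / 4

-- Peel off the shell of [r]³ where some coordinate equals r.  A shell triple
-- with x = r or y = r can be 2-less than another triple of [r]³ only through
-- its last two coordinates, so in a 2-comparable set those triples have
-- distinct z; likewise those with x = r or z = r have distinct y, and those
-- with x < r and (y = r or z = r) have distinct x < r.  Every shell triple
-- lies in two of these three classes, so twice the shell has at most
-- r + r + (r - 1) elements.  Summing ⌊(3r - 1)/2⌋ over the shells of
-- [r]³, [r-1]³, … gives 3m² for r = 2m and 3m² + 3m + 1 for r = 2m + 1.
module Submission where

open import Defs
open import Data.Nat using (ℕ; zero; suc; NonZero; _+_; _*_; _/_; _%_; _≤_; _<_; z≤n; s≤s; _≟_)
open import Data.Nat.DivMod using (m≡m%n+[m/n]*n; m%n<n; m*n/n≡m; /-monoˡ-≤; +-distrib-/-∣ʳ)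
open import Data.Nat.Divisibility using (divides-refl)
open import Data.Nat.Properties
open import Data.Nat.Tactic.RingSolver using (solve-∀)
open import Data.List using (List; []; _∷_; length; map; filter)
open import Data.List.Properties using (length-map)
open import Data.List.Relation.Unary.All as All using (All; []; _∷_)
open import Data.List.Relation.Unary.All.Properties as Allₚ using (all-filter; filter⁺)
open import Data.List.Relation.Unary.AllPairs using (AllPairs; []; _∷_)
import Data.List.Relation.Unary.AllPairs.Properties as AllPairsₚ
open import Data.Product using (_×_; _,_; proj₁; proj₂)
open import Data.Sum using (_⊎_; inj₁; inj₂)
open import Function using (_∘_)
open import Level using (Level)
open import Relation.Binary.PropositionalEquality
open import Relation.Binary using (Rel)
open import Relation.Nullary using (¬_; Dec; yes; no; contradiction)
open import Relation.Unary using (Pred; Decidable; ∁; _∪_; _∩_)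
open import Relation.Unary.Properties using (∁?; _∪?_; _∩?_)

private variable
  ℓ ℓ′ : Level
  A : Set ℓ

indicator : {B : Set ℓ} → Dec B → ℕ
indicator (yes _) = 1
indicator (no _)  = 0

indicator-yes : {B : Set ℓ} (b? : Dec B) → B → indicator b? ≡ 1
indicator-yes (yes _) _ = refl
indicator-yes (no ¬b) b = contradiction b ¬b

module _ {P : Pred A ℓ} (P? : Decidable P) where

  length-filter-∷ : ∀ x xs → length (filter P? (x ∷ xs)) ≡ indicator (P? x) + length (filter P? xs)
  length-filter-∷ x xs with P? x
  ... | yes _ = refl
  ... | no _  = refl

  length-filter+length-filter-∁ : ∀ xs → length (filter P? xs) + length (filter (∁? P?) xs) ≡ length xs
  length-filter+length-filter-∁ []       = refl
  length-filter+length-filter-∁ (x ∷ xs) with P? x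
  ... | yes _ = cong suc (length-filter+length-filter-∁ xs)
  ... | no _  = trans (+-suc _ _) (cong suc (length-filter+length-filter-∁ xs))

  All-filter : {Q : Pred A ℓ′} {xs : List A} → All Q xs → All (Q ∩ P) (filter P? xs)
  All-filter {xs = xs} qs = All.zip (filter⁺ P? qs , all-filter P? xs)

module _ {P Q R S : Pred A ℓ} (P? : Decidable P) (Q? : Decidable Q) (R? : Decidable R) (S? : Decidable S)
         (covered-twice : ∀ {x} → P x → (Q x × R x) ⊎ (Q x × S x) ⊎ (R x × S x)) where

  private
    indicator-covered-twice : ∀ x → 2 * indicator (P? x) ≤ indicator (Q? x) + indicator (R? x) + indicator (S? x)
    indicator-covered-twice x with P? x
    ... | no _ = z≤n
    ... | yes px with covered-twice px
    ...   | inj₁ (qx , rx)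
      rewrite indicator-yes (Q? x) qx | indicator-yes (R? x) rx = m≤m+n 2 _
    ...   | inj₂ (inj₁ (qx , sx))
      rewrite indicator-yes (Q? x) qx | indicator-yes (S? x) sx = s≤s (m≤n+m 1 _)
    ...   | inj₂ (inj₂ (rx , sx))
      rewrite indicator-yes (R? x) rx | indicator-yes (S? x) sx = +-monoˡ-≤ 1 (m≤n+m 1 _)

  2*length-filter≤ : ∀ xs → 2 * length (filter P? xs) ≤
                     length (filter Q? xs) + length (filter R? xs) + length (filter S? xs)
  2*length-filter≤ []       = z≤n
  2*length-filter≤ (x ∷ xs) = begin
    2 * length (filter P? (x ∷ xs))
      ≡⟨ cong (2 *_) (length-filter-∷ P? x xs) ⟩
    2 * (iP + lP)
      ≡⟨ *-distribˡ-+ 2 iP lP ⟩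
    2 * iP + 2 * lP
      ≤⟨ +-mono-≤ (indicator-covered-twice x) (2*length-filter≤ xs) ⟩
    (iQ + iR + iS) + (lQ + lR + lS)
      ≡⟨ interchange iQ iR iS lQ lR lS ⟩
    (iQ + lQ) + (iR + lR) + (iS + lS)
      ≡⟨ sym (cong₂ _+_ (cong₂ _+_ (length-filter-∷ Q? x xs) (length-filter-∷ R? x xs)) (length-filter-∷ S? x xs)) ⟩
    length (filter Q? (x ∷ xs)) + length (filter R? (x ∷ xs)) + length (filter S? (x ∷ xs)) ∎
    where
    open ≤-Reasoning
    iP iQ iR iS lP lQ lR lS : ℕ
    iP = indicator (P? x); iQ = indicator (Q? x); iR = indicator (R? x); iS = indicator (S? x)
    lP = length (filter P? xs); lQ = length (filter Q? xs); lR = length (filter R? xs); lS = length (filter S? xs)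
    interchange : ∀ a b c d e f → (a + b + c) + (d + e + f) ≡ (a + d) + (b + e) + (c + f)
    interchange = solve-∀

AllPairs-mapWithAll : {P : Pred A ℓ} {R S : Rel A ℓ′} → (∀ {x y} → P x → P y → R x y → S x y) →
                      ∀ {xs} → All P xs → AllPairs R xs → AllPairs S xs
AllPairs-mapWithAll h []         []         = []
AllPairs-mapWithAll h (px ∷ pxs) (rxs ∷ rs) =
  All.zipWith (λ (py , rxy) → h px py rxy) (pxs , rxs) ∷ AllPairs-mapWithAll h pxs rs

In[0]-empty : ∀ {x} → ¬ In[ 0 ] x
In[0]-empty (1≤x , x≤0) = contradiction (≤-trans 1≤x x≤0) λ ()

In-below : ∀ {k x} → In[ suc k ] x → x ≢ suc k → In[ k ] x
In-below (1≤x , x≤1+k) x≢1+k = 1≤x , m<1+n⇒m≤n (≤∧≢⇒< x≤1+k x≢1+k)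

length≤1-if-constant : ∀ {c : ℕ} {xs} → All (_≡ c) xs → AllPairs _≢_ xs → length xs ≤ 1
length≤1-if-constant []              _               = z≤n
length≤1-if-constant (_ ∷ [])        _               = s≤s z≤n
length≤1-if-constant (x≡c ∷ y≡c ∷ _) ((x≢y ∷ _) ∷ _) = contradiction (trans x≡c (sym y≡c)) x≢y

length≤-if-distinct-In : ∀ n {xs} → All In[ n ] xs → AllPairs _≢_ xs → length xs ≤ n
length≤-if-distinct-In zero    {[]}    _        _        = z≤n
length≤-if-distinct-In zero    {_ ∷ _} (x∈ ∷ _) _        = contradiction x∈ In[0]-empty
length≤-if-distinct-In (suc n) {xs}    xs⊆[1+n] distinct = begin
  length xs
    ≡⟨ sym (length-filter+length-filter-∁ (_≟ suc n) xs) ⟩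
  length (filter (_≟ suc n) xs) + length (filter (∁? (_≟ suc n)) xs)
    ≤⟨ +-mono-≤ (length≤1-if-constant (all-filter (_≟ suc n) xs) (AllPairsₚ.filter⁺ _ distinct))
                (length≤-if-distinct-In n rest⊆[n] (AllPairsₚ.filter⁺ _ distinct)) ⟩
  1 + n ∎
  where
  open ≤-Reasoning
  rest⊆[n] : All In[ n ] (filter (∁? (_≟ suc n)) xs)
  rest⊆[n] = All.map (λ (x∈ , x≢1+n) → In-below x∈ x≢1+n) (All-filter (∁? (_≟ suc n)) xs⊆[1+n])

π₁ π₂ π₃ : Triple → ℕ
π₁ (x , _ , _) = x
π₂ (_ , y , _) = y
π₃ (_ , _ , z) = z

Face₁ Face₂ Face₃ Shell : ℕ → Pred Triple Level.zero
Face₁ r a = π₁ a ≡ r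
Face₂ r a = π₂ a ≡ r
Face₃ r a = π₃ a ≡ r
Shell r = Face₁ r ∪ Face₂ r ∪ Face₃ r

face₁? : ∀ r → Decidable (Face₁ r)
face₁? r a = π₁ a ≟ r

face₂? : ∀ r → Decidable (Face₂ r)
face₂? r a = π₂ a ≟ r

face₃? : ∀ r → Decidable (Face₃ r)
face₃? r a = π₃ a ≟ r

shell? : ∀ r → Decidable (Shell r)
shell? r = face₁? r ∪? face₂? r ∪? face₃? r

below-shell : ∀ {k a} → In[ suc k ]³ a → ¬ Shell (suc k) a → In[ k ]³ a
below-shell (x∈ , y∈ , z∈) a∉ =
  In-below x∈ (a∉ ∘ inj₁) , In-below y∈ (a∉ ∘ inj₂ ∘ inj₁) , In-below z∈ (a∉ ∘ inj₂ ∘ inj₂)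

face₁-<₂ : ∀ {r y z u v w} → u ≤ r → (r , y , z) <₂ (u , v , w) → y < v × z < w
face₁-<₂ u≤r (inj₁ (r<u , _))        = contradiction r<u (≤⇒≯ u≤r)
face₁-<₂ u≤r (inj₂ (inj₁ (r<u , _))) = contradiction r<u (≤⇒≯ u≤r)
face₁-<₂ _   (inj₂ (inj₂ y<v×z<w))   = y<v×z<w

face₂-<₂ : ∀ {r x z u v w} → v ≤ r → (x , r , z) <₂ (u , v , w) → x < u × z < w
face₂-<₂ v≤r (inj₁ (_ , r<v))        = contradiction r<v (≤⇒≯ v≤r)
face₂-<₂ _   (inj₂ (inj₁ x<u×z<w))   = x<u×z<w
face₂-<₂ v≤r (inj₂ (inj₂ (r<v , _))) = contradiction r<v (≤⇒≯ v≤r)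

face₃-<₂ : ∀ {r x y u v w} → w ≤ r → (x , y , r) <₂ (u , v , w) → x < u × y < v
face₃-<₂ _   (inj₁ x<u×y<v)          = x<u×y<v
face₃-<₂ w≤r (inj₂ (inj₁ (_ , r<w))) = contradiction r<w (≤⇒≯ w≤r)
face₃-<₂ w≤r (inj₂ (inj₂ (_ , r<w))) = contradiction r<w (≤⇒≯ w≤r)

module _ {r n : ℕ} {P : Pred Triple ℓ} (P? : Decidable P) (f : Triple → ℕ)
         (f-In : ∀ {a} → In[ r ]³ a → P a → In[ n ] (f a))
         (f-<₂-mono : ∀ {a b} → In[ r ]³ b → P a → a <₂ b → f a < f b) where

  length-filter≤-by-<₂-monotone : ∀ {T} → All In[ r ]³ T → AllPairs 2-comparable T → length (filter P? T) ≤ n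
  length-filter≤-by-<₂-monotone {T} T⊆[r]³ comparable = begin
    length (filter P? T)         ≡⟨ sym (length-map f (filter P? T)) ⟩
    length (map f (filter P? T)) ≤⟨ length≤-if-distinct-In n f[T∩P]⊆[n] f[T∩P]-distinct ⟩
    n                            ∎
    where
    open ≤-Reasoning
    T∩P : All (In[ r ]³ ∩ P) (filter P? T)
    T∩P = All-filter P? T⊆[r]³
    f[T∩P]⊆[n] : All In[ n ] (map f (filter P? T))
    f[T∩P]⊆[n] = Allₚ.map⁺ (All.map (λ (a∈ , pa) → f-In a∈ pa) T∩P)
    f-distinct : ∀ {a b} → (In[ r ]³ ∩ P) a → (In[ r ]³ ∩ P) b → 2-comparable a b → f a ≢ f b
    f-distinct (_  , pa) (b∈ , _)  (inj₁ a<b) = <⇒≢ (f-<₂-mono b∈ pa a<b)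
    f-distinct (a∈ , _)  (_  , pb) (inj₂ b<a) = >⇒≢ (f-<₂-mono a∈ pb b<a)
    f[T∩P]-distinct : AllPairs _≢_ (map f (filter P? T))
    f[T∩P]-distinct = AllPairsₚ.map⁺ (AllPairs-mapWithAll f-distinct T∩P (AllPairsₚ.filter⁺ P? comparable))

Face₁₂ Face₁₃ Face₂₃∖₁ : ℕ → Pred Triple Level.zero
Face₁₂ r = Face₁ r ∪ Face₂ r
Face₁₃ r = Face₁ r ∪ Face₃ r
Face₂₃∖₁ r = ∁ (Face₁ r) ∩ (Face₂ r ∪ Face₃ r)

face₁₂? : ∀ r → Decidable (Face₁₂ r)
face₁₂? r = face₁? r ∪? face₂? r

face₁₃? : ∀ r → Decidable (Face₁₃ r)
face₁₃? r = face₁? r ∪? face₃? r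

face₂₃∖₁? : ∀ r → Decidable (Face₂₃∖₁ r)
face₂₃∖₁? r = ∁? (face₁? r) ∩? (face₂? r ∪? face₃? r)

length-face₁₂≤ : ∀ {r T} → All In[ r ]³ T → AllPairs 2-comparable T → length (filter (face₁₂? r) T) ≤ r
length-face₁₂≤ {r} = length-filter≤-by-<₂-monotone (face₁₂? r) π₃ π₃-In π₃-mono
  where
  π₃-In : ∀ {a} → In[ r ]³ a → Face₁₂ r a → In[ r ] (π₃ a)
  π₃-In {_ , _ , _} (_ , _ , z∈) _ = z∈
  π₃-mono : ∀ {a b} → In[ r ]³ b → Face₁₂ r a → a <₂ b → π₃ a < π₃ b
  π₃-mono {_ , _ , _} {_ , _ , _} ((_ , u≤r) , _)     (inj₁ refl) a<b = proj₂ (face₁-<₂ u≤r a<b)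
  π₃-mono {_ , _ , _} {_ , _ , _} (_ , (_ , v≤r) , _) (inj₂ refl) a<b = proj₂ (face₂-<₂ v≤r a<b)

length-face₁₃≤ : ∀ {r T} → All In[ r ]³ T → AllPairs 2-comparable T → length (filter (face₁₃? r) T) ≤ r
length-face₁₃≤ {r} = length-filter≤-by-<₂-monotone (face₁₃? r) π₂ π₂-In π₂-mono
  where
  π₂-In : ∀ {a} → In[ r ]³ a → Face₁₃ r a → In[ r ] (π₂ a)
  π₂-In {_ , _ , _} (_ , y∈ , _) _ = y∈
  π₂-mono : ∀ {a b} → In[ r ]³ b → Face₁₃ r a → a <₂ b → π₂ a < π₂ b
  π₂-mono {_ , _ , _} {_ , _ , _} ((_ , u≤r) , _)     (inj₁ refl) a<b = proj₁ (face₁-<₂ u≤r a<b)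
  π₂-mono {_ , _ , _} {_ , _ , _} (_ , _ , (_ , w≤r)) (inj₂ refl) a<b = proj₂ (face₃-<₂ w≤r a<b)

length-face₂₃∖₁≤ : ∀ {k T} → All In[ suc k ]³ T → AllPairs 2-comparable T →
                   length (filter (face₂₃∖₁? (suc k)) T) ≤ k
length-face₂₃∖₁≤ {k} = length-filter≤-by-<₂-monotone (face₂₃∖₁? (suc k)) π₁ π₁-In π₁-mono
  where
  π₁-In : ∀ {a} → In[ suc k ]³ a → Face₂₃∖₁ (suc k) a → In[ k ] (π₁ a)
  π₁-In {_ , _ , _} (x∈ , _ , _) (x≢r , _) = In-below x∈ x≢r
  π₁-mono : ∀ {a b} → In[ suc k ]³ b → Face₂₃∖₁ (suc k) a → a <₂ b → π₁ a < π₁ b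
  π₁-mono {_ , _ , _} {_ , _ , _} (_ , (_ , v≤r) , _) (_ , inj₁ refl) a<b = proj₁ (face₂-<₂ v≤r a<b)
  π₁-mono {_ , _ , _} {_ , _ , _} (_ , _ , (_ , w≤r)) (_ , inj₂ refl) a<b = proj₁ (face₃-<₂ w≤r a<b)

shell-covered-twice : ∀ {r a} → Shell r a →
  (Face₁₂ r a × Face₁₃ r a) ⊎ (Face₁₂ r a × Face₂₃∖₁ r a) ⊎ (Face₁₃ r a × Face₂₃∖₁ r a)
shell-covered-twice {r} {a} a∈ with π₁ a ≟ r
... | yes x≡r = inj₁ (inj₁ x≡r , inj₁ x≡r)
... | no x≢r with a∈
...   | inj₁ x≡r        = contradiction x≡r x≢r
...   | inj₂ (inj₁ y≡r) = inj₂ (inj₁ (inj₂ y≡r , x≢r , inj₁ y≡r))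
...   | inj₂ (inj₂ z≡r) = inj₂ (inj₂ (inj₂ z≡r , x≢r , inj₂ z≡r))

2*length-shell≤ : ∀ k {T} → All In[ suc k ]³ T → AllPairs 2-comparable T →
                  2 * length (filter (shell? (suc k)) T) ≤ 3 * k + 2
2*length-shell≤ k {T} T⊆[r]³ comparable = begin
  2 * length (filter (shell? r) T)
    ≤⟨ 2*length-filter≤ (shell? r) (face₁₂? r) (face₁₃? r) (face₂₃∖₁? r) shell-covered-twice T ⟩
  length (filter (face₁₂? r) T) + length (filter (face₁₃? r) T) + length (filter (face₂₃∖₁? r) T)
    ≤⟨ +-mono-≤ (+-mono-≤ (length-face₁₂≤ T⊆[r]³ comparable) (length-face₁₃≤ T⊆[r]³ comparable))
                (length-face₂₃∖₁≤ T⊆[r]³ comparable) ⟩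
  r + r + k
    ≡⟨ r+r+k≡3k+2 k ⟩
  3 * k + 2 ∎
  where
  open ≤-Reasoning
  r : ℕ
  r = suc k
  r+r+k≡3k+2 : ∀ k → suc k + suc k + k ≡ 3 * k + 2
  r+r+k≡3k+2 = solve-∀

m*n≤o⇒n≤o/m : ∀ m {n o} .{{_ : NonZero m}} → m * n ≤ o → n ≤ o / m
m*n≤o⇒n≤o/m m {n} {o} m*n≤o = subst (_≤ o / m) (m*n/n≡m n m) (/-monoˡ-≤ m (subst (_≤ o) (*-comm m n) m*n≤o))

shellBound : ℕ → ℕ
shellBound k = (3 * k + 2) / 2

sizeBound : ℕ → ℕ
sizeBound zero    = 0
sizeBound (suc k) = shellBound k + sizeBound k

length≤sizeBound : ∀ r {T} → All In[ r ]³ T → AllPairs 2-comparable T → length T ≤ sizeBound r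
length≤sizeBound zero    {[]}    _              _          = z≤n
length≤sizeBound zero    {_ ∷ _} ((x∈ , _) ∷ _) _          = contradiction x∈ In[0]-empty
length≤sizeBound (suc k) {T}     T⊆[r]³         comparable = begin
  length T
    ≡⟨ sym (length-filter+length-filter-∁ (shell? (suc k)) T) ⟩
  length (filter (shell? (suc k)) T) + length (filter (∁? (shell? (suc k))) T)
    ≤⟨ +-mono-≤ (m*n≤o⇒n≤o/m 2 (2*length-shell≤ k T⊆[r]³ comparable))
                (length≤sizeBound k rest⊆[k]³ (AllPairsₚ.filter⁺ _ comparable)) ⟩
  shellBound k + sizeBound k ∎
  where
  open ≤-Reasoning
  rest⊆[k]³ : All In[ k ]³ (filter (∁? (shell? (suc k))) T)
  rest⊆[k]³ = All.map (λ (a∈ , a∉) → below-shell a∈ a∉) (All-filter (∁? (shell? (suc k))) T⊆[r]³)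

shellBound-even : ∀ m → shellBound (m * 2) ≡ 3 * m + 1
shellBound-even m = begin
  (3 * (m * 2) + 2) / 2 ≡⟨ cong (_/ 2) (ring m) ⟩
  (3 * m + 1) * 2 / 2   ≡⟨ m*n/n≡m (3 * m + 1) 2 ⟩
  3 * m + 1             ∎
  where
  open ≡-Reasoning
  ring : ∀ m → 3 * (m * 2) + 2 ≡ (3 * m + 1) * 2
  ring = solve-∀

shellBound-odd : ∀ m → shellBound (suc (m * 2)) ≡ 3 * m + 2
shellBound-odd m = begin
  (3 * suc (m * 2) + 2) / 2     ≡⟨ cong (_/ 2) (ring m) ⟩
  (1 + (3 * m + 2) * 2) / 2     ≡⟨ +-distrib-/-∣ʳ 1 {d = 2} (divides-refl (3 * m + 2)) ⟩
  1 / 2 + (3 * m + 2) * 2 / 2   ≡⟨ m*n/n≡m (3 * m + 2) 2 ⟩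
  3 * m + 2                     ∎
  where
  open ≡-Reasoning
  ring : ∀ m → 3 * suc (m * 2) + 2 ≡ 1 + (3 * m + 2) * 2
  ring = solve-∀

sizeBound-even : ∀ m → sizeBound (m * 2) ≡ 3 * (m * m)
sizeBound-even zero    = refl
sizeBound-even (suc m) = begin
  shellBound (suc (m * 2)) + (shellBound (m * 2) + sizeBound (m * 2))
    ≡⟨ cong₂ _+_ (shellBound-odd m) (cong₂ _+_ (shellBound-even m) (sizeBound-even m)) ⟩
  (3 * m + 2) + ((3 * m + 1) + 3 * (m * m))
    ≡⟨ ring m ⟩
  3 * (suc m * suc m) ∎
  where
  open ≡-Reasoning
  ring : ∀ m → (3 * m + 2) + ((3 * m + 1) + 3 * (m * m)) ≡ 3 * (suc m * suc m)
  ring = solve-∀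

sizeBound-odd : ∀ m → sizeBound (suc (m * 2)) ≡ 3 * m + 1 + 3 * (m * m)
sizeBound-odd m = cong₂ _+_ (shellBound-even m) (sizeBound-even m)

sizeBound≤t : ∀ r → sizeBound r ≤ t r
sizeBound≤t r with r % 2 in r%2≡
... | 0 = subst (λ n → sizeBound n ≤ 3 * (n * n) / 4) (sym r≡[r/2]*2) (even (r / 2))
  where
  r≡[r/2]*2 : r ≡ r / 2 * 2
  r≡[r/2]*2 = trans (m≡m%n+[m/n]*n r 2) (cong (_+ r / 2 * 2) r%2≡)
  even : ∀ m → sizeBound (m * 2) ≤ 3 * (m * 2 * (m * 2)) / 4
  even m = m*n≤o⇒n≤o/m 4 (≤-reflexive (trans (cong (4 *_) (sizeBound-even m)) (ring m)))
    where
    ring : ∀ m → 4 * (3 * (m * m)) ≡ 3 * (m * 2 * (m * 2))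
    ring = solve-∀
... | 1 = subst (λ n → sizeBound n ≤ (3 * (n * n) + 2 * n + 3) / 4) (sym r≡1+[r/2]*2) (odd (r / 2))
  where
  r≡1+[r/2]*2 : r ≡ suc (r / 2 * 2)
  r≡1+[r/2]*2 = trans (m≡m%n+[m/n]*n r 2) (cong (_+ r / 2 * 2) r%2≡)
  odd : ∀ m → sizeBound (suc (m * 2)) ≤ (3 * (suc (m * 2) * suc (m * 2)) + 2 * suc (m * 2) + 3) / 4
  odd m = m*n≤o⇒n≤o/m 4 (begin
    4 * sizeBound (suc (m * 2))                   ≡⟨ cong (4 *_) (sizeBound-odd m) ⟩
    4 * (3 * m + 1 + 3 * (m * m))                 ≤⟨ m≤m+n _ (4 * m + 4) ⟩
    4 * (3 * m + 1 + 3 * (m * m)) + (4 * m + 4)   ≡⟨ ring m ⟩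
    3 * (suc (m * 2) * suc (m * 2)) + 2 * suc (m * 2) + 3 ∎)
    where
    open ≤-Reasoning
    ring : ∀ m → 4 * (3 * m + 1 + 3 * (m * m)) + (4 * m + 4) ≡
                  3 * (suc (m * 2) * suc (m * 2)) + 2 * suc (m * 2) + 3
    ring = solve-∀
... | suc (suc _) = contradiction (subst (_< 2) r%2≡ (m%n<n r 2)) λ { (s≤s (s≤s ())) }

lemma2p4 : (r : ℕ) → .{{_ : NonZero r}} → (T : List Triple) →
           All In[ r ]³ T → AllPairs 2-comparable T →
           length T ≤ t r
lemma2p4 r T T⊆[r]³ comparable = ≤-trans (length≤sizeBound r T⊆[r]³ comparable) (sizeBound≤t r)
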